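{- Let $a,\ell,n$ be non-negative integers with $\ell\ge1$, and for an integer $z$ let $\widehat{z}$ denote the least non-negative residue of $z$ modulo $\ell$. Then \[n^2\,\widehat{a}\,(\ell-\widehat{a})\equiv \widehat{na}\,(\ell-\widehat{na})\pmod{2\ell}.\] -}

module Defs where

open import Data.Nat using (ℕ; NonZero; _%_)

hat : (ℓ : ℕ) → .{{NonZero ℓ}} → ℕ → ℕ
hat ℓ z = z % ℓ

module Submission where

-- Write r = â and s = (na)^, so that n·r ≡ s (mod ℓ), and put t = ℓ − r, u = ℓ − s.
-- Dividing n·r by ℓ gives n·r = s + q·ℓ; since n·r + n·t = n·ℓ, also
-- s + n·t = m·ℓ with m = n − q.  Under these two relations a ring computation gives
--     (n·r)(n·t) + 2ℓ·s = s·u + ℓ·E,     E = s(1 + m) + q·n·t,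
-- and a second one gives  E + 2qs + q(q+1)ℓ = n·r·(n + 1),  so E is even because
-- products of consecutive numbers are.  Hence (n·r)(n·t) ≡ s·u (mod 2ℓ).

open import Defs
open import Data.Nat using (ℕ; NonZero; zero; suc; _+_; _*_; _∸_; _^_; _%_; _/_; _≤_)
open import Data.Nat.Properties
open import Data.Nat.DivMod
open import Data.Nat.Divisibility using (_∣_; divides; n∣m*n; ∣n⇒∣m*n; ∣m∣n⇒∣m+n; ∣m+n∣m⇒∣n)
open import Data.Nat.Tactic.RingSolver using (solve-∀)
open import Data.Product using (∃-syntax; _,_)
open import Relation.Binary.PropositionalEquality
open ≡-Reasoning

even-pronic : ∀ k → 2 ∣ k * suc k
even-pronic zero    = divides 0 refl
even-pronic (suc k) =
  subst (2 ∣_) (step k) (∣m∣n⇒∣m+n (even-pronic k) (n∣m*n (suc k)))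
  where
  step : ∀ k → k * suc k + suc k * 2 ≡ suc k * suc (suc k)
  step = solve-∀

pronic-multiple-even : ∀ n r → 2 ∣ n * r * suc n
pronic-multiple-even n r = subst (2 ∣_) (regroup n r) (∣n⇒∣m*n r (even-pronic n))
  where
  regroup : ∀ n r → r * (n * suc n) ≡ n * r * suc n
  regroup = solve-∀

square-product : ∀ n x y → n ^ 2 * x * y ≡ (n * x) * (n * y)
square-product n x y = trans (cong (λ z → n * z * x * y) (*-identityʳ n)) (regroup n x y)
  where
  regroup : ∀ n x y → n * n * x * y ≡ (n * x) * (n * y)
  regroup = solve-∀

mod-shift : ∀ x y i j d .{{_ : NonZero d}} → x + i * d ≡ y + j * d → x % d ≡ y % d
mod-shift x y i j d eq = begin
  x % d           ≡⟨ sym ([m+kn]%n≡m%n x i d) ⟩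
  (x + i * d) % d ≡⟨ cong (_% d) eq ⟩
  (y + j * d) % d ≡⟨ [m+kn]%n≡m%n y j d ⟩
  y % d           ∎

residue-scaling : ∀ n a ℓ .{{_ : NonZero ℓ}} → (n * (a % ℓ)) % ℓ ≡ (n * a) % ℓ
residue-scaling n a ℓ = sym (begin
  (n * a) % ℓ                               ≡⟨ cong (λ z → (n * z) % ℓ) (m≡m%n+[m/n]*n a ℓ) ⟩
  (n * (a % ℓ + (a / ℓ) * ℓ)) % ℓ           ≡⟨ cong (_% ℓ) (expand n (a % ℓ) (a / ℓ) ℓ) ⟩
  (n * (a % ℓ) + (n * (a / ℓ)) * ℓ) % ℓ     ≡⟨ [m+kn]%n≡m%n (n * (a % ℓ)) (n * (a / ℓ)) ℓ ⟩
  (n * (a % ℓ)) % ℓ                         ∎)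
  where
  expand : ∀ n r k ℓ → n * (r + k * ℓ) ≡ n * r + (n * k) * ℓ
  expand = solve-∀

quotient-bound : ∀ n {r} ℓ .{{_ : NonZero ℓ}} → r ≤ ℓ → (n * r) / ℓ ≤ n
quotient-bound n ℓ r≤ℓ =
  ≤-trans (/-monoˡ-≤ ℓ (*-monoʳ-≤ n r≤ℓ)) (≤-reflexive (m*n/n≡m n ℓ))

complement-multiple : ∀ {n r t s q ℓ} → n * r ≡ s + q * ℓ → r + t ≡ ℓ → q ≤ n →
                      s + n * t ≡ (n ∸ q) * ℓ
complement-multiple {n} {r} {t} {s} {q} {ℓ} nr≡ r+t≡ℓ q≤n = +-cancelˡ-≡ (q * ℓ) _ _ (begin
  q * ℓ + (s + n * t) ≡⟨ sym (+-assoc (q * ℓ) s (n * t)) ⟩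
  q * ℓ + s + n * t   ≡⟨ cong (_+ n * t) (trans (+-comm (q * ℓ) s) (sym nr≡)) ⟩
  n * r + n * t       ≡⟨ sym (*-distribˡ-+ n r t) ⟩
  n * (r + t)         ≡⟨ cong (n *_) r+t≡ℓ ⟩
  n * ℓ               ≡⟨ cong (_* ℓ) (sym (m+[n∸m]≡n q≤n)) ⟩
  (q + (n ∸ q)) * ℓ   ≡⟨ *-distribʳ-+ ℓ q (n ∸ q) ⟩
  q * ℓ + (n ∸ q) * ℓ ∎)

complementary-product-sum : ∀ s u q m y → s + y ≡ m * (s + u) →
  (s + q * (s + u)) * y + s * (2 * (s + u)) ≡ s * u + (s + u) * (s * suc m + q * y)
complementary-product-sum s u q m y s+y≡mℓ = begin
  (s + q * ℓ) * y + s * (2 * ℓ)         ≡⟨ expand s u q y ⟩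
  s * (s + y) + s * u + ℓ * (s + q * y) ≡⟨ cong (λ z → s * z + s * u + ℓ * (s + q * y)) s+y≡mℓ ⟩
  s * (m * ℓ) + s * u + ℓ * (s + q * y) ≡⟨ collect s u q m y ⟩
  s * u + ℓ * (s * suc m + q * y)       ∎
  where
  ℓ = s + u
  expand : ∀ s u q y → (s + q * (s + u)) * y + s * (2 * (s + u))
                     ≡ s * (s + y) + s * u + (s + u) * (s + q * y)
  expand = solve-∀
  collect : ∀ s u q m y → s * (m * (s + u)) + s * u + (s + u) * (s + q * y)
                        ≡ s * u + (s + u) * (s * suc m + q * y)
  collect = solve-∀

-- In the same setting the coefficient E differs from x·(1 + q + m) by the even number
-- 2qs + q(q+1)ℓ; so E is even as soon as x·(1 + q + m) is.
complementary-coefficient-even : ∀ s u q m y → s + y ≡ m * (s + u) →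
  2 ∣ (s + q * (s + u)) * suc (q + m) → 2 ∣ s * suc m + q * y
complementary-coefficient-even s u q m y s+y≡mℓ x[1+q+m]-even =
  ∣m+n∣m⇒∣n (subst (2 ∣_) excess-sum x[1+q+m]-even)
             (∣m∣n⇒∣m+n (n∣m*n (q * s)) (∣n⇒∣m*n ℓ (even-pronic q)))
  where
  ℓ = s + u
  excess-sum : (s + q * ℓ) * suc (q + m) ≡ (q * s * 2 + ℓ * (q * suc q)) + (s * suc m + q * y)
  excess-sum = begin
    (s + q * ℓ) * suc (q + m)                         ≡⟨ expand s u q m ⟩
    q * s + ℓ * (q * suc q) + s * suc m + q * (m * ℓ)
      ≡⟨ cong (λ z → q * s + ℓ * (q * suc q) + s * suc m + q * z) (sym s+y≡mℓ) ⟩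
    q * s + ℓ * (q * suc q) + s * suc m + q * (s + y) ≡⟨ collect s u q m y ⟩
    (q * s * 2 + ℓ * (q * suc q)) + (s * suc m + q * y) ∎
    where
    expand : ∀ s u q m → (s + q * (s + u)) * suc (q + m)
                       ≡ q * s + (s + u) * (q * suc q) + s * suc m + q * (m * (s + u))
    expand = solve-∀
    collect : ∀ s u q m y → q * s + (s + u) * (q * suc q) + s * suc m + q * (s + y)
                          ≡ (q * s * 2 + (s + u) * (q * suc q)) + (s * suc m + q * y)
    collect = solve-∀

complementary-product : ∀ {s u ℓ} q m x y → s + u ≡ ℓ →
                        x ≡ s + q * ℓ → s + y ≡ m * ℓ → 2 ∣ x * suc (q + m) →
                        ∃[ k ] x * y + s * (2 * ℓ) ≡ s * u + k * (2 * ℓ)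
complementary-product {s} {u} q m x y refl refl s+y≡mℓ x[1+q+m]-even
  with complementary-coefficient-even s u q m y s+y≡mℓ x[1+q+m]-even
... | divides h E≡h*2 = h , (begin
  x * y + s * (2 * ℓ)                 ≡⟨ complementary-product-sum s u q m y s+y≡mℓ ⟩
  s * u + ℓ * (s * suc m + q * y)     ≡⟨ cong (λ z → s * u + ℓ * z) E≡h*2 ⟩
  s * u + ℓ * (h * 2)                 ≡⟨ cong (s * u +_) (regroup ℓ h) ⟩
  s * u + h * (2 * ℓ)                 ∎)
  where
  ℓ = s + u
  regroup : ∀ ℓ h → ℓ * (h * 2) ≡ h * (2 * ℓ)
  regroup = solve-∀

lemma2p2 : (a ℓ n : ℕ) → .{{_ : NonZero ℓ}} →
    let instance nz2ℓ = m*n≢0 2 ℓ in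
    ((n ^ 2) * hat ℓ a * (ℓ ∸ hat ℓ a)) % (2 * ℓ)
      ≡ (hat ℓ (n * a) * (ℓ ∸ hat ℓ (n * a))) % (2 * ℓ)
lemma2p2 a ℓ n = from-additive
  (complementary-product q (n ∸ q) (n * r) (n * t) s+u≡ℓ nr≡ complement parity)
  where
  instance nz2ℓ = m*n≢0 2 ℓ
  r = a % ℓ
  s = (n * a) % ℓ
  t = ℓ ∸ r
  u = ℓ ∸ s
  q = (n * r) / ℓ

  s+u≡ℓ : s + u ≡ ℓ
  s+u≡ℓ = m+[n∸m]≡n (m%n≤n (n * a) ℓ)

  nr≡ : n * r ≡ s + q * ℓ
  nr≡ = trans (m≡m%n+[m/n]*n (n * r) ℓ) (cong (_+ q * ℓ) (residue-scaling n a ℓ))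

  q≤n : q ≤ n
  q≤n = quotient-bound n ℓ (m%n≤n a ℓ)

  complement : s + n * t ≡ (n ∸ q) * ℓ
  complement = complement-multiple nr≡ (m+[n∸m]≡n (m%n≤n a ℓ)) q≤n

  parity : 2 ∣ n * r * suc (q + (n ∸ q))
  parity = subst (λ z → 2 ∣ n * r * suc z) (sym (m+[n∸m]≡n q≤n)) (pronic-multiple-even n r)

  from-additive : ∃[ k ] (n * r) * (n * t) + s * (2 * ℓ) ≡ s * u + k * (2 * ℓ) →
                  (n ^ 2 * r * t) % (2 * ℓ) ≡ (s * u) % (2 * ℓ)
  from-additive (k , product≡) =
    mod-shift _ _ s k (2 * ℓ) (trans (cong (_+ s * (2 * ℓ)) (square-product n r t)) product≡)
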